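{- Let $\omega=e^{2\pi i/3}$. Call $\alpha\in\mathbb Z[\omega]$ with $\gcd(N(\alpha),6)=1$ even if it can be written as $\alpha=\omega^j(A+3B\omega)$ with $j\in\{0,1,2\}$, $A,B\in\mathbb Z$, $3\nmid A$, $A,B$ not both even, and $2\mid B$; call it odd if it can be so written with $2\nmid B$. Then: (i) no $\alpha$ is both even and odd; (ii) $\alpha$ and its complex conjugate $\bar\alpha$ have the same parity; (iii) if $\alpha$ and $\alpha'$ are both even, then $\alpha\alpha'$ is even.
   Context: $N(\alpha)=\alpha\bar\alpha$ is the norm from $\mathbb Z[\omega]$ to $\mathbb Z$; $N(a+b\omega)=a^2-ab+b^2$. -}

module Defs where

open import Data.Integer using (ℤ; +_; -_; _+_; _-_; _*_; ∣_∣)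
open import Data.Integer.Divisibility using (_∣_)
open import Data.Nat using (ℕ; zero; suc)
import Data.Nat as ℕ
open import Data.Nat.GCD using (gcd)
open import Data.Fin using (Fin; toℕ)
open import Data.Product using (Σ; _×_; _,_)
open import Relation.Nullary using (¬_)
open import Relation.Binary.PropositionalEquality using (_≡_)

-- mk a b denotes a + bω.
-- Eisenstein integers ℤ[ω], ω = e^{2πi/3}, represented as a + bω with ω² = -1 - ω.
record ℤω : Set where
  constructor mk
  field
    re : ℤ
    im : ℤ
open ℤω public

_*ω_ : ℤω → ℤω → ℤω
mk a b *ω mk c d = mk (a * c - b * d) (a * d + b * c - b * d)

ω : ℤω
ω = mk (+ 0) (+ 1)

-- complex conjugate: conj(a + bω) = a + bω² = (a - b) - bω
conj : ℤω → ℤω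
conj (mk a b) = mk (a - b) (- b)

ωpow : ℕ → ℤω
ωpow zero = mk (+ 1) (+ 0)
ωpow (suc j) = ω *ω ωpow j

N : ℤω → ℤ
N (mk a b) = a * a - a * b + b * b

CoprimeTo6 : ℤω → Set
CoprimeTo6 α = gcd ∣ N α ∣ 6 ≡ 1

Representation : (ℤ → Set) → ℤω → Set
Representation BParity α =
  Σ (Fin 3) λ j → Σ ℤ λ A → Σ ℤ λ B →
    (α ≡ ωpow (toℕ j) *ω mk A ((+ 3) * B))
    × ¬ ((+ 3) ∣ A)
    × ¬ (((+ 2) ∣ A) × ((+ 2) ∣ B))
    × BParity B

Even : ℤω → Set
Even α = CoprimeTo6 α × Representation (λ B → (+ 2) ∣ B) α

Odd : ℤω → Set
Odd α = CoprimeTo6 α × Representation (λ B → ¬ ((+ 2) ∣ B)) α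

{-# OPTIONS --safe #-}
module Submission where

-- Multiplication by ω sends a + bω to -b + (a - b)ω, so the imaginary part of
-- ω^j (A + 3Bω) is 3B, A - 3B or -A for j = 0, 1, 2; when 3 ∤ A it is a multiple of 3
-- only for j = 0. As ω is a unit with ω³ = 1, an equality ω^j (A + 3Bω) = ω^k (A′ + 3B′ω)
-- rotates to A + 3Bω = ω^(k-j) (A′ + 3B′ω), which forces B = B′: the parity of B is an
-- invariant of α. Conjugation sends ω^j (A + 3Bω) to ω^(2j) ((A - 3B) - 3Bω), and a product
-- of two representations is ω^(j+k) ((AA′ - 9BB′) + 3(AB′ + A′B - 3BB′)ω); the side
-- conditions survive both (for the product when B and B′ are even, since 2 and 3 are prime),
-- while the norm is conjugation-invariant and multiplicative.

open import Defs
open import Data.Product using (_×_)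
open import Relation.Nullary using (¬_)
open import Function.Bundles using (_⇔_)

open import Data.Empty using (⊥-elim)
open import Data.Fin using (Fin; toℕ)
open import Data.Fin.Patterns using (0F; 1F; 2F)
open import Data.Fin.Properties using (toℕ≤n)
open import Data.Integer using (ℤ; +_; -_; _+_; _-_; _*_; ∣_∣)
open import Data.Integer.Divisibility using (_∣_)
import Data.Integer.Divisibility.Signed as Signed
open import Data.Integer.Properties using (∣-i∣≡∣i∣; abs-*; *-cancelˡ-≡; neg-involutive; neg-distribʳ-*)
open import Data.Integer.Tactic.RingSolver using (solve; solve-∀)
open import Data.List using (_∷_; [])
open import Data.Nat using (ℕ; zero; suc; _∸_)
import Data.Nat as ℕ
import Data.Nat.Divisibility as ℕ
open import Data.Nat.Coprimality using (Coprime; coprime⇒gcd≡1; gcd≡1⇒coprime; coprime-divisor)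
open import Data.Nat.DivMod using (_mod_; _/_; _divMod_; DivMod)
open import Data.Nat.GCD using (gcd)
open import Data.Nat.Primality using (Prime; prime[2]; prime?; euclidsLemma)
open import Data.Nat.Properties using (m∸n+n≡m)
open import Data.Product using (_,_)
open import Data.Sum using (_⊎_; [_,_]′)
open import Function.Base using (_∘_)
open import Function.Bundles using (mk⇔)
open import Relation.Nullary.Decidable using (from-yes)
open import Relation.Binary.PropositionalEquality
open ≡-Reasoning

*ω-identityˡ : ∀ x → ωpow 0 *ω x ≡ x
*ω-identityˡ (mk a b) = cong₂ mk (solve (a ∷ b ∷ [])) (solve (a ∷ b ∷ []))

*ω-identityʳ : ∀ x → x *ω ωpow 0 ≡ x
*ω-identityʳ (mk a b) = cong₂ mk (solve (a ∷ b ∷ [])) (solve (a ∷ b ∷ []))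

*ω-comm : ∀ x y → x *ω y ≡ y *ω x
*ω-comm (mk a b) (mk c d) = cong₂ mk (solve (a ∷ b ∷ c ∷ d ∷ [])) (solve (a ∷ b ∷ c ∷ d ∷ []))

*ω-assoc : ∀ x y z → (x *ω y) *ω z ≡ x *ω (y *ω z)
*ω-assoc (mk a b) (mk c d) (mk e f) = cong₂ mk (re-assoc a b c d e f) (im-assoc a b c d e f)
  where
  re-assoc : ∀ a b c d e f →
    (a * c - b * d) * e - (a * d + b * c - b * d) * f
    ≡ a * (c * e - d * f) - b * (c * f + d * e - d * f)
  re-assoc = solve-∀
  im-assoc : ∀ a b c d e f →
    (a * c - b * d) * f + (a * d + b * c - b * d) * e - (a * d + b * c - b * d) * f
    ≡ a * (c * f + d * e - d * f) + b * (c * e - d * f) - b * (c * f + d * e - d * f)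
  im-assoc = solve-∀

*ω-interchange : ∀ w x y z → (w *ω x) *ω (y *ω z) ≡ (w *ω y) *ω (x *ω z)
*ω-interchange w x y z = begin
  (w *ω x) *ω (y *ω z) ≡⟨ *ω-assoc w x (y *ω z) ⟩
  w *ω (x *ω (y *ω z)) ≡⟨ cong (w *ω_) (sym (*ω-assoc x y z)) ⟩
  w *ω ((x *ω y) *ω z) ≡⟨ cong (λ u → w *ω (u *ω z)) (*ω-comm x y) ⟩
  w *ω ((y *ω x) *ω z) ≡⟨ cong (w *ω_) (*ω-assoc y x z) ⟩
  w *ω (y *ω (x *ω z)) ≡⟨ sym (*ω-assoc w y (x *ω z)) ⟩
  (w *ω y) *ω (x *ω z) ∎

ωpow-+ : ∀ m n → ωpow (m ℕ.+ n) ≡ ωpow m *ω ωpow n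
ωpow-+ zero    n = sym (*ω-identityˡ (ωpow n))
ωpow-+ (suc m) n = trans (cong (ω *ω_) (ωpow-+ m n)) (sym (*ω-assoc ω (ωpow m) (ωpow n)))

ωpow-*ω : ∀ m n x → ωpow m *ω (ωpow n *ω x) ≡ ωpow (m ℕ.+ n) *ω x
ωpow-*ω m n x = trans (sym (*ω-assoc (ωpow m) (ωpow n) x)) (cong (_*ω x) (sym (ωpow-+ m n)))

ωpow[q*3]≡1 : ∀ q → ωpow (q ℕ.* 3) ≡ ωpow 0
ωpow[q*3]≡1 zero    = refl
ωpow[q*3]≡1 (suc q) = trans (ωpow-+ 3 (q ℕ.* 3)) (cong (ωpow 3 *ω_) (ωpow[q*3]≡1 q))

ωpow-mod-3 : ∀ n → ωpow n ≡ ωpow (toℕ (n mod 3))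
ωpow-mod-3 n = begin
  ωpow n                          ≡⟨ cong ωpow (DivMod.property (n divMod 3)) ⟩
  ωpow (toℕ r ℕ.+ q ℕ.* 3)        ≡⟨ ωpow-+ (toℕ r) (q ℕ.* 3) ⟩
  ωpow (toℕ r) *ω ωpow (q ℕ.* 3)  ≡⟨ cong (ωpow (toℕ r) *ω_) (ωpow[q*3]≡1 q) ⟩
  ωpow (toℕ r) *ω ωpow 0          ≡⟨ *ω-identityʳ (ωpow (toℕ r)) ⟩
  ωpow (toℕ r)                    ∎
  where
  r : Fin 3
  r = n mod 3
  q : ℕ
  q = n / 3

ωpow-inverse : ∀ (j : Fin 3) x → ωpow (3 ∸ toℕ j) *ω (ωpow (toℕ j) *ω x) ≡ x
ωpow-inverse j x = begin
  ωpow (3 ∸ toℕ j) *ω (ωpow (toℕ j) *ω x) ≡⟨ ωpow-*ω (3 ∸ toℕ j) (toℕ j) x ⟩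
  ωpow (3 ∸ toℕ j ℕ.+ toℕ j) *ω x         ≡⟨ cong (λ n → ωpow n *ω x) (m∸n+n≡m (toℕ≤n j)) ⟩
  ωpow 3 *ω x                              ≡⟨ *ω-identityˡ x ⟩
  x                                        ∎

conj-involutive : ∀ x → conj (conj x) ≡ x
conj-involutive (mk a b) = cong₂ mk (re-conj² a b) (neg-involutive b)
  where
  re-conj² : ∀ a b → (a - b) - (- b) ≡ a
  re-conj² = solve-∀

conj-*ω : ∀ x y → conj (x *ω y) ≡ conj x *ω conj y
conj-*ω (mk a b) (mk c d) = cong₂ mk (re-conj a b c d) (im-conj a b c d)
  where
  re-conj : ∀ a b c d →
    (a * c - b * d) - (a * d + b * c - b * d) ≡ (a - b) * (c - d) - (- b) * (- d)
  re-conj = solve-∀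
  im-conj : ∀ a b c d →
    - (a * d + b * c - b * d) ≡ (a - b) * (- d) + (- b) * (c - d) - (- b) * (- d)
  im-conj = solve-∀

conj-ωpow : ∀ n → conj (ωpow n) ≡ ωpow (n ℕ.* 2)
conj-ωpow zero    = refl
conj-ωpow (suc n) = begin
  conj (ω *ω ωpow n)        ≡⟨ conj-*ω ω (ωpow n) ⟩
  ωpow 2 *ω conj (ωpow n)   ≡⟨ cong (ωpow 2 *ω_) (conj-ωpow n) ⟩
  ωpow 2 *ω ωpow (n ℕ.* 2)  ≡⟨ ωpow-+ 2 (n ℕ.* 2) ⟨
  ωpow (suc n ℕ.* 2)        ∎

N-conj : ∀ x → N (conj x) ≡ N x
N-conj (mk a b) = N-conj′ a b
  where
  N-conj′ : ∀ a b → (a - b) * (a - b) - (a - b) * (- b) + (- b) * (- b) ≡ a * a - a * b + b * b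
  N-conj′ = solve-∀

N-*ω : ∀ x y → N (x *ω y) ≡ N x * N y
N-*ω (mk a b) (mk c d) = N-*ω′ a b c d
  where
  N-*ω′ : ∀ a b c d →
    (a * c - b * d) * (a * c - b * d) - (a * c - b * d) * (a * d + b * c - b * d)
      + (a * d + b * c - b * d) * (a * d + b * c - b * d)
    ≡ (a * a - a * b + b * b) * (c * c - c * d + d * d)
  N-*ω′ = solve-∀

coprime-*ˡ : ∀ {m n k} → Coprime m k → Coprime n k → Coprime (m ℕ.* n) k
coprime-*ˡ m⊥k n⊥k (d∣mn , d∣k) =
  n⊥k (coprime-divisor (λ (e∣d , e∣m) → m⊥k (e∣m , ℕ.∣-trans e∣d d∣k)) d∣mn , d∣k)

CoprimeTo6-conj : ∀ α → CoprimeTo6 α → CoprimeTo6 (conj α)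
CoprimeTo6-conj α = subst (λ n → gcd ∣ n ∣ 6 ≡ 1) (sym (N-conj α))

CoprimeTo6-*ω : ∀ α β → CoprimeTo6 α → CoprimeTo6 β → CoprimeTo6 (α *ω β)
CoprimeTo6-*ω α β α⊥6 β⊥6 = begin
  gcd (∣ N (α *ω β) ∣) 6        ≡⟨ cong (λ n → gcd ∣ n ∣ 6) (N-*ω α β) ⟩
  gcd (∣ N α * N β ∣) 6         ≡⟨ cong (λ n → gcd n 6) (abs-* (N α) (N β)) ⟩
  gcd (∣ N α ∣ ℕ.* ∣ N β ∣) 6   ≡⟨ coprime⇒gcd≡1 (coprime-*ˡ (gcd≡1⇒coprime {∣ N α ∣} α⊥6)
                                                              (gcd≡1⇒coprime {∣ N β ∣} β⊥6)) ⟩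
  1                             ∎

∣m⇒∣-m : ∀ {p} m → + p ∣ m → + p ∣ - m
∣m⇒∣-m {p} m = subst (p ℕ.∣_) (sym (∣-i∣≡∣i∣ m))

∣-m⇒∣m : ∀ {p} m → + p ∣ - m → + p ∣ m
∣-m⇒∣m {p} m = subst (p ℕ.∣_) (∣-i∣≡∣i∣ m)

∣n⇒∣m*n : ∀ {p} m n → + p ∣ n → + p ∣ m * n
∣n⇒∣m*n {p} m n p∣n = subst (p ℕ.∣_) (sym (abs-* m n)) (ℕ.∣n⇒∣m*n ∣ m ∣ p∣n)

∣m⇒∣m*n : ∀ {p} m n → + p ∣ m → + p ∣ m * n
∣m⇒∣m*n {p} m n p∣m = subst (p ℕ.∣_) (sym (abs-* m n)) (ℕ.∣m⇒∣m*n ∣ n ∣ p∣m)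

p∣p*n : ∀ p n → + p ∣ + p * n
p∣p*n p n = ∣m⇒∣m*n (+ p) n ℕ.∣-refl

∣m-n∣n⇒∣m : ∀ {p} m n → + p ∣ m - n → + p ∣ n → + p ∣ m
∣m-n∣n⇒∣m {p} m n p∣m-n p∣n = Signed.∣⇒∣ᵤ {+ p} {m}
  (Signed.∣m+n∣n⇒∣m (Signed.∣ᵤ⇒∣ {+ p} {m - n} p∣m-n) (Signed.∣m⇒∣-m (Signed.∣ᵤ⇒∣ {+ p} {n} p∣n)))

∣m∣n∣o⇒∣m+n-o : ∀ {p} m n o → + p ∣ m → + p ∣ n → + p ∣ o → + p ∣ m + n - o
∣m∣n∣o⇒∣m+n-o {p} m n o p∣m p∣n p∣o = Signed.∣⇒∣ᵤ {+ p} {m + n - o} (Signed.∣m∣n⇒∣m-n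
  (Signed.∣m∣n⇒∣m+n (Signed.∣ᵤ⇒∣ {+ p} {m} p∣m) (Signed.∣ᵤ⇒∣ {+ p} {n} p∣n)) (Signed.∣ᵤ⇒∣ {+ p} {o} p∣o))

prime∣m*n⇒∣m⊎∣n : ∀ {p} → Prime p → ∀ m n → + p ∣ m * n → (+ p ∣ m) ⊎ (+ p ∣ n)
prime∣m*n⇒∣m⊎∣n {p} pp m n p∣mn = euclidsLemma ∣ m ∣ ∣ n ∣ pp (subst (p ℕ.∣_) (abs-* m n) p∣mn)

prime∤m*n-o : ∀ {p} → Prime p → ∀ m n o → ¬ + p ∣ m → ¬ + p ∣ n → + p ∣ o → ¬ + p ∣ m * n - o
prime∤m*n-o pp m n o p∤m p∤n p∣o p∣mn-o =
  [ p∤m , p∤n ]′ (prime∣m*n⇒∣m⊎∣n pp m n (∣m-n∣n⇒∣m (m * n) o p∣mn-o p∣o))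

prime[3] : Prime 3
prime[3] = from-yes (prime? 3)

mk₃ : ℤ → ℤ → ℤω
mk₃ A B = mk A (+ 3 * B)

im-ω*ω : ∀ a b → im (ωpow 1 *ω mk a b) ≡ a - b
im-ω*ω a b = im-ω*ω′ a b
  where
  im-ω*ω′ : ∀ a b → + 0 * b + + 1 * a - + 1 * b ≡ a - b
  im-ω*ω′ = solve-∀

im-ω²*ω : ∀ a b → im (ωpow 2 *ω mk a b) ≡ - a
im-ω²*ω a b = im-ω²*ω′ a b
  where
  im-ω²*ω′ : ∀ a b → (- + 1) * b + (- + 1) * a - (- + 1) * b ≡ - a
  im-ω²*ω′ = solve-∀

mk₃≡ωpow*mk₃⇒B≡ : ∀ (j : Fin 3) {A B A′ B′} → ¬ + 3 ∣ A′ →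
                  mk₃ A B ≡ ωpow (toℕ j) *ω mk₃ A′ B′ → B ≡ B′
mk₃≡ωpow*mk₃⇒B≡ 0F {B = B} {A′} {B′} _ eq =
  *-cancelˡ-≡ (+ 3) B B′ (trans (cong im eq) (cong im (*ω-identityˡ (mk₃ A′ B′))))
mk₃≡ωpow*mk₃⇒B≡ 1F {B = B} {A′} {B′} 3∤A′ eq = ⊥-elim (3∤A′ (∣m-n∣n⇒∣m A′ (+ 3 * B′)
  (subst (+ 3 ∣_) (trans (cong im eq) (im-ω*ω A′ (+ 3 * B′))) (p∣p*n 3 B)) (p∣p*n 3 B′)))
mk₃≡ωpow*mk₃⇒B≡ 2F {B = B} {A′} {B′} 3∤A′ eq = ⊥-elim (3∤A′ (∣-m⇒∣m A′
  (subst (+ 3 ∣_) (trans (cong im eq) (im-ω²*ω A′ (+ 3 * B′))) (p∣p*n 3 B))))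

ωpow*mk₃≡ωpow*mk₃⇒B≡ : ∀ (j k : Fin 3) {A B A′ B′} → ¬ + 3 ∣ A′ →
  ωpow (toℕ j) *ω mk₃ A B ≡ ωpow (toℕ k) *ω mk₃ A′ B′ → B ≡ B′
ωpow*mk₃≡ωpow*mk₃⇒B≡ j k {A} {B} {A′} {B′} 3∤A′ eq = mk₃≡ωpow*mk₃⇒B≡ (n mod 3) 3∤A′ (begin
  mk₃ A B                                         ≡⟨ ωpow-inverse j (mk₃ A B) ⟨
  ωpow (3 ∸ toℕ j) *ω (ωpow (toℕ j) *ω mk₃ A B)   ≡⟨ cong (ωpow (3 ∸ toℕ j) *ω_) eq ⟩
  ωpow (3 ∸ toℕ j) *ω (ωpow (toℕ k) *ω mk₃ A′ B′) ≡⟨ ωpow-*ω (3 ∸ toℕ j) (toℕ k) (mk₃ A′ B′) ⟩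
  ωpow n *ω mk₃ A′ B′                             ≡⟨ cong (_*ω mk₃ A′ B′) (ωpow-mod-3 n) ⟩
  ωpow (toℕ (n mod 3)) *ω mk₃ A′ B′               ∎)
  where
  n : ℕ
  n = 3 ∸ toℕ j ℕ.+ toℕ k

representation : ∀ {P α} n A B → α ≡ ωpow n *ω mk₃ A B →
                 ¬ + 3 ∣ A → ¬ ((+ 2 ∣ A) × (+ 2 ∣ B)) → P B → Representation P α
representation n A B α≡ 3∤A ¬2∣A×B pB =
  n mod 3 , A , B , trans α≡ (cong (_*ω mk₃ A B) (ωpow-mod-3 n)) ,
  3∤A , ¬2∣A×B , pB

¬Even×Odd : ∀ α → ¬ (Even α × Odd α)
¬Even×Odd α ((_ , j , A , B , α≡ , _ , _ , 2∣B) , (_ , k , A′ , B′ , α≡′ , 3∤A′ , _ , 2∤B′)) =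
  2∤B′ (subst (+ 2 ∣_) (ωpow*mk₃≡ωpow*mk₃⇒B≡ j k 3∤A′ (trans (sym α≡) α≡′)) 2∣B)

conj-mk₃ : ∀ A B → conj (mk₃ A B) ≡ mk₃ (A - + 3 * B) (- B)
conj-mk₃ A B = cong (mk (A - + 3 * B)) (neg-distribʳ-* (+ 3) B)

Representation-conj : ∀ {P : ℤ → Set} → (∀ {B} → P B → P (- B)) →
                      ∀ {α} → Representation P α → Representation P (conj α)
Representation-conj P-neg {α} (j , A , B , α≡ , 3∤A , ¬2∣A×B , pB) =
  representation (toℕ j ℕ.* 2) (A - + 3 * B) (- B) conj-α≡ 3∤A-3B ¬2∣A-3B×-B (P-neg pB)
  where
  conj-α≡ : conj α ≡ ωpow (toℕ j ℕ.* 2) *ω mk₃ (A - + 3 * B) (- B)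
  conj-α≡ = begin
    conj α                                     ≡⟨ cong conj α≡ ⟩
    conj (ωpow (toℕ j) *ω mk₃ A B)             ≡⟨ conj-*ω (ωpow (toℕ j)) (mk₃ A B) ⟩
    conj (ωpow (toℕ j)) *ω conj (mk₃ A B)      ≡⟨ cong₂ _*ω_ (conj-ωpow (toℕ j)) (conj-mk₃ A B) ⟩
    ωpow (toℕ j ℕ.* 2) *ω mk₃ (A - + 3 * B) (- B) ∎
  3∤A-3B : ¬ + 3 ∣ A - + 3 * B
  3∤A-3B 3∣A-3B = 3∤A (∣m-n∣n⇒∣m A (+ 3 * B) 3∣A-3B (p∣p*n 3 B))
  ¬2∣A-3B×-B : ¬ ((+ 2 ∣ A - + 3 * B) × (+ 2 ∣ - B))
  ¬2∣A-3B×-B (2∣A-3B , 2∣-B) = ¬2∣A×B (∣m-n∣n⇒∣m A (+ 3 * B) 2∣A-3B (∣n⇒∣m*n (+ 3) B 2∣B) , 2∣B)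
    where
    2∣B : + 2 ∣ B
    2∣B = ∣-m⇒∣m B 2∣-B

Even-conj : ∀ α → Even α → Even (conj α)
Even-conj α (α⊥6 , r) = CoprimeTo6-conj α α⊥6 , Representation-conj (λ {B} → ∣m⇒∣-m B) r

Odd-conj : ∀ α → Odd α → Odd (conj α)
Odd-conj α (α⊥6 , r) = CoprimeTo6-conj α α⊥6 , Representation-conj (λ {B} 2∤B → 2∤B ∘ ∣-m⇒∣m B) r

conj-closed⇒⇔ : ∀ {P : ℤω → Set} → (∀ α → P α → P (conj α)) → ∀ α → P α ⇔ P (conj α)
conj-closed⇒⇔ {P} P-conj α = mk⇔ (P-conj α) (subst P (conj-involutive α) ∘ P-conj (conj α))

mk₃-*ω-mk₃ : ∀ A B A′ B′ → mk₃ A B *ω mk₃ A′ B′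
             ≡ mk₃ (A * A′ - + 3 * (+ 3 * (B * B′))) (A * B′ + A′ * B - + 3 * (B * B′))
mk₃-*ω-mk₃ A B A′ B′ = cong₂ mk (re-* A B A′ B′) (im-* A B A′ B′)
  where
  re-* : ∀ A B A′ B′ → A * A′ - (+ 3 * B) * (+ 3 * B′) ≡ A * A′ - + 3 * (+ 3 * (B * B′))
  re-* = solve-∀
  im-* : ∀ A B A′ B′ → A * (+ 3 * B′) + (+ 3 * B) * A′ - (+ 3 * B) * (+ 3 * B′)
                       ≡ + 3 * (A * B′ + A′ * B - + 3 * (B * B′))
  im-* = solve-∀

Even-*ω : ∀ α β → Even α → Even β → Even (α *ω β)
Even-*ω α β (α⊥6 , j , A , B , α≡ , 3∤A , ¬2∣A×B , 2∣B) (β⊥6 , k , A′ , B′ , β≡ , 3∤A′ , ¬2∣A′×B′ , 2∣B′) =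
  CoprimeTo6-*ω α β α⊥6 β⊥6 ,
  representation (toℕ j ℕ.+ toℕ k) A″ B″ αβ≡ 3∤A″ (λ (2∣A″ , _) → 2∤A″ 2∣A″) 2∣B″
  where
  A″ B″ : ℤ
  A″ = A * A′ - + 3 * (+ 3 * (B * B′))
  B″ = A * B′ + A′ * B - + 3 * (B * B′)
  αβ≡ : α *ω β ≡ ωpow (toℕ j ℕ.+ toℕ k) *ω mk₃ A″ B″
  αβ≡ = begin
    α *ω β
      ≡⟨ cong₂ _*ω_ α≡ β≡ ⟩
    (ωpow (toℕ j) *ω mk₃ A B) *ω (ωpow (toℕ k) *ω mk₃ A′ B′)
      ≡⟨ *ω-interchange (ωpow (toℕ j)) (mk₃ A B) (ωpow (toℕ k)) (mk₃ A′ B′) ⟩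
    (ωpow (toℕ j) *ω ωpow (toℕ k)) *ω (mk₃ A B *ω mk₃ A′ B′)
      ≡⟨ cong₂ _*ω_ (sym (ωpow-+ (toℕ j) (toℕ k))) (mk₃-*ω-mk₃ A B A′ B′) ⟩
    ωpow (toℕ j ℕ.+ toℕ k) *ω mk₃ A″ B″
      ∎
  2∣3BB′ : + 2 ∣ + 3 * (B * B′)
  2∣3BB′ = ∣n⇒∣m*n (+ 3) (B * B′) (∣m⇒∣m*n B B′ 2∣B)
  3∤A″ : ¬ + 3 ∣ A″
  3∤A″ = prime∤m*n-o prime[3] A A′ (+ 3 * (+ 3 * (B * B′))) 3∤A 3∤A′ (p∣p*n 3 (+ 3 * (B * B′)))
  2∤A″ : ¬ + 2 ∣ A″
  2∤A″ = prime∤m*n-o prime[2] A A′ (+ 3 * (+ 3 * (B * B′)))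
    (λ 2∣A → ¬2∣A×B (2∣A , 2∣B)) (λ 2∣A′ → ¬2∣A′×B′ (2∣A′ , 2∣B′)) (∣n⇒∣m*n (+ 3) (+ 3 * (B * B′)) 2∣3BB′)
  2∣B″ : + 2 ∣ B″
  2∣B″ = ∣m∣n∣o⇒∣m+n-o (A * B′) (A′ * B) (+ 3 * (B * B′))
    (∣n⇒∣m*n A B′ 2∣B′) (∣n⇒∣m*n A′ B 2∣B) 2∣3BB′

lemma3 : ((α : ℤω) → ¬ (Even α × Odd α))
         × ((α : ℤω) → (Even α ⇔ Even (conj α)) × (Odd α ⇔ Odd (conj α)))
         × ((α α′ : ℤω) → Even α → Even α′ → Even (α *ω α′))
lemma3 = ¬Even×Odd , (λ α → conj-closed⇒⇔ Even-conj α , conj-closed⇒⇔ Odd-conj α) , Even-*ω
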